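{- If $\Phi\vdash\psi$ in the natural deduction system for $\mathsf{BSML}$, then $\Phi\vDash\psi$.
   Context: Formulas of $\mathsf{BSML}$: $\phi ::= p \mid \neg\phi \mid \phi\wedge\phi \mid \phi\vee\phi \mid \Diamond\phi \mid \mathrm{NE}$; $\mathsf{ML}$ is the $\mathrm{NE}$-free fragment; $\Box\phi:=\neg\Diamond\neg\phi$, $\bot:=p\wedge\neg p$, $\bot\!\!\!\bot:=\bot\wedge\mathrm{NE}$. Semantics on Kripke models $M=(W,R,V)$ and states $s\subseteq W$ ($R[w]=\{v\mid wRv\}$), support $\vDash$ / anti-support $\mathrel{=\!\!\mid}$: $s\vDash p$ iff $s\subseteq V(p)$; $s\mathrel{=\!\!\mid} p$ iff $s\cap V(p)=\emptyset$; $s\vDash\mathrm{NE}$ iff $s\neq\emptyset$; $s\mathrel{=\!\!\mid}\mathrm{NE}$ iff $s=\emptyset$; $s\vDash\neg\phi$ iff $s\mathrel{=\!\!\mid}\phi$; $s\mathrel{=\!\!\mid}\neg\phi$ iff $s\vDash\phi$; $s\vDash\phi\wedge\psi$ iff both supported; $s\mathrel{=\!\!\mid}\phi\wedge\psi$ iff $s=t\cup u$, $t\mathrel{=\!\!\mid}\phi$, $u\mathrel{=\!\!\mid}\psi$; $s\vDash\phi\vee\psi$ iff $s=t\cup u$, $t\vDash\phi$, $u\vDash\psi$; $s\mathrel{=\!\!\mid}\phi\vee\psi$ iff both anti-supported; $s\vDash\Diamond\phi$ iff every $w\in s$ has nonempty $t\subseteq R[w]$ with $t\vDash\phi$; $s\mathrel{=\!\!\mid}\Diamond\phi$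 iff $R[w]\mathrel{=\!\!\mid}\phi$ for all $w\in s$. $\Phi\vDash\psi$: every $M,s$ supporting all of $\Phi$ supports $\psi$. An occurrence $[\psi]$ in $\phi$ is distributive if it is not in the scope of any $\neg$ or $\Diamond$ in $\phi$ (counting those inside $\Box=\neg\Diamond\neg$). The natural deduction system (metavariables $\alpha,\beta$ range over $\mathsf{ML}$ only; "$\dashv\vdash$" means both directions are rules; no uniform substitution) has rules: $\wedge$I, $\wedge$E (standard); $\neg$I: from a derivation of $\bot$ from $[\alpha]$ infer $\neg\alpha$, if undischarged assumptions contain no $\mathrm{NE}$; $\neg$E: $\alpha,\neg\alpha\vdash\beta$; $\neg\neg\phi\dashv\vdash\phi$; $\neg(\phi\wedge\psi)\dashv\vdash\neg\phi\vee\neg\psi$; $\neg(\phi\vee\psi)\dashv\vdash\neg\phi\wedge\neg\psi$; $\neg\mathrm{NE}\dashv\vdash\bot$; $\vee$I: $\phi\vdash\phi\vee\psi$ if $\psi$ contains no $\mathrm{NE}$; $\phi\vdash\phi\vee\phi$; $\phi\vee\psi\vdash\psi\vee\phi$; $\vee$E: from $\phi\vee\psi$ and derivations of $\chi$ from $[\phi]$ and from $[\psi]$ infer $\chi$, if the undischarged assumptions of those derivations contain no $\mathrm{NE}$; $\vee$Mon: from $\phi\vee\psi$ and a derivation of $\chi$ from $[\psi]$ (other undischarged assumptions $\mathrm{NE}$-free) infer $\phi\vee\chi$; $\bot\vee\phi\vdash\phi$; $\bot\!\!\!\bot\vee\phi\vdash\psi$; $\Diamond$Mon: from a derivation of $\psi$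 from $[\phi]$ with no other undischarged assumptions and $\Diamond\phi$ infer $\Diamond\psi$; $\Box$Mon: from a derivation of $\psi$ from $[\phi_1],\dots,[\phi_n]$ with no other undischarged assumptions and $\Box\phi_1,\dots,\Box\phi_n$ infer $\Box\psi$; $\neg\Diamond\phi\dashv\vdash\Box\neg\phi$; $\Diamond(\phi\vee(\psi\wedge\mathrm{NE}))\vdash\Diamond\psi$; $\Diamond\phi,\Diamond\psi\vdash\Diamond(\phi\vee\psi)$; $\Box(\phi\wedge\mathrm{NE})\vdash\Diamond\phi$; $\Box\phi,\Diamond\psi\vdash\Box(\phi\vee\psi)$; $\bot\mathrm{NE}$-translation: from $\phi$, a derivation of $\chi$ from $[\phi[\psi\wedge\mathrm{NE}/\psi]]$ and a derivation of $\chi$ from $[\phi[\psi\wedge\bot/\psi]]$ infer $\chi$; $\Diamond\phi\vdash\Diamond\phi[\psi\wedge\mathrm{NE}/\psi]\vee\Diamond\phi[\psi\wedge\bot/\psi]$; $\Box\phi\vdash\Box\phi[\psi\wedge\mathrm{NE}/\psi]\vee\Box\phi[\psi\wedge\bot/\psi]$; where in the last three rules the replaced occurrence $[\psi]$ is distributive in $\phi$. -}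

module Defs where

open import Level using (Level; 0ℓ; Lift) renaming (suc to lsuc)
open import Data.Nat using (ℕ)
open import Data.List using (List; []; _∷_; _++_)
open import Data.List.Membership.Propositional using (_∈_)
open import Data.List.Relation.Unary.All using (All)
open import Data.Product using (Σ; _×_; ∃)
open import Data.Sum using (_⊎_)
open import Data.Empty using (⊥)
open import Data.Unit using (⊤)
open import Relation.Unary using (Pred; _⊆_; _≐_; _∪_; _∩_; Empty; Satisfiable)

infixr 30 ~_ ◇_ □_
infixr 20 _∧_
infixr 15 _∨_

data Form : Set where
  var : ℕ → Form
  ~_  : Form → Form
  _∧_ : Form → Form → Form
  _∨_ : Form → Form → Form
  ◇_  : Form → Form
  NE  : Form

□_ : Form → Form
□ φ = ~ ◇ ~ φ

bot : Form
bot = var 0 ∧ ~ var 0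

botbot : Form
botbot = bot ∧ NE

ML : Form → Set
ML (var p) = ⊤
ML (~ φ)   = ML φ
ML (φ ∧ ψ) = ML φ × ML ψ
ML (φ ∨ ψ) = ML φ × ML ψ
ML (◇ φ)   = ML φ
ML NE      = ⊥

-- Distributive occurrences: contexts built only from ∧ and ∨
-- (so the hole is not in the scope of any ¬ or ◇).

data DCtx : Set where
  hole : DCtx
  _∧ₗ_ : DCtx → Form → DCtx
  _∧ᵣ_ : Form → DCtx → DCtx
  _∨ₗ_ : DCtx → Form → DCtx
  _∨ᵣ_ : Form → DCtx → DCtx

plug : DCtx → Form → Form
plug hole      χ = χ
plug (C ∧ₗ φ)  χ = plug C χ ∧ φ
plug (φ ∧ᵣ C)  χ = φ ∧ plug C χ
plug (C ∨ₗ φ)  χ = plug C χ ∨ φ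
plug (φ ∨ᵣ C)  χ = φ ∨ plug C χ

record Model : Set₁ where
  field
    W : Set
    R : W → W → Set
    V : ℕ → Pred W 0ℓ

open Model public

State : Model → Set₁
State M = Pred (W M) 0ℓ

succs : (M : Model) → W M → State M
succs M w = λ v → R M w v

mutual
  supp : (M : Model) → State M → Form → Set₁
  supp M s (var p) = Lift (lsuc 0ℓ) (s ⊆ V M p)
  supp M s (~ φ)   = anti M s φ
  supp M s (φ ∧ ψ) = supp M s φ × supp M s ψ
  supp M s (φ ∨ ψ) = Σ (State M) λ t → Σ (State M) λ u →
                       Lift (lsuc 0ℓ) (s ≐ (t ∪ u)) × supp M t φ × supp M u ψ
  supp M s (◇ φ)   = ∀ w → s w → Σ (State M) λ t →
                       Lift (lsuc 0ℓ) (t ⊆ succs M w) × Lift (lsuc 0ℓ) (Satisfiable t) × supp M t φ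
  supp M s NE      = Lift (lsuc 0ℓ) (Satisfiable s)

  anti : (M : Model) → State M → Form → Set₁
  anti M s (var p) = Lift (lsuc 0ℓ) (Empty (s ∩ V M p))
  anti M s (~ φ)   = supp M s φ
  anti M s (φ ∧ ψ) = Σ (State M) λ t → Σ (State M) λ u →
                       Lift (lsuc 0ℓ) (s ≐ (t ∪ u)) × anti M t φ × anti M u ψ
  anti M s (φ ∨ ψ) = anti M s φ × anti M s ψ
  anti M s (◇ φ)   = ∀ w → s w → anti M (succs M w) φ
  anti M s NE      = Lift (lsuc 0ℓ) (Empty s)

_⊨ₛ_ : Pred Form 0ℓ → Form → Set₁
Φ ⊨ₛ ψ = (M : Model) (s : State M) → (∀ φ → Φ φ → supp M s φ) → supp M s ψ

-- Natural deduction.  Γ ⊢ φ : there is a derivation of φ whose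
-- undischarged assumptions are among Γ.

AllML : List Form → Set
AllML Γ = All ML Γ

_⊆ₗ_ : List Form → List Form → Set
Γ ⊆ₗ Δ = ∀ {x} → x ∈ Γ → x ∈ Δ

infix 5 _⊢_

data _⊢_ : List Form → Form → Set where
  hyp  : ∀ {Γ φ} → φ ∈ Γ → Γ ⊢ φ
  weak : ∀ {Γ Δ φ} → Γ ⊆ₗ Δ → Γ ⊢ φ → Δ ⊢ φ
  ∧I   : ∀ {Γ φ ψ} → Γ ⊢ φ → Γ ⊢ ψ → Γ ⊢ φ ∧ ψ
  ∧E₁  : ∀ {Γ φ ψ} → Γ ⊢ φ ∧ ψ → Γ ⊢ φ
  ∧E₂  : ∀ {Γ φ ψ} → Γ ⊢ φ ∧ ψ → Γ ⊢ ψ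
  ¬I   : ∀ {Γ α} → ML α → AllML Γ → (α ∷ Γ) ⊢ bot → Γ ⊢ ~ α
  ¬E   : ∀ {Γ α β} → ML α → ML β → Γ ⊢ α → Γ ⊢ ~ α → Γ ⊢ β
  ¬¬E  : ∀ {Γ φ} → Γ ⊢ ~ ~ φ → Γ ⊢ φ
  ¬¬I  : ∀ {Γ φ} → Γ ⊢ φ → Γ ⊢ ~ ~ φ
  dm∧₁ : ∀ {Γ φ ψ} → Γ ⊢ ~ (φ ∧ ψ) → Γ ⊢ ~ φ ∨ ~ ψ
  dm∧₂ : ∀ {Γ φ ψ} → Γ ⊢ ~ φ ∨ ~ ψ → Γ ⊢ ~ (φ ∧ ψ)
  dm∨₁ : ∀ {Γ φ ψ} → Γ ⊢ ~ (φ ∨ ψ) → Γ ⊢ ~ φ ∧ ~ ψ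
  dm∨₂ : ∀ {Γ φ ψ} → Γ ⊢ ~ φ ∧ ~ ψ → Γ ⊢ ~ (φ ∨ ψ)
  ¬NE₁ : ∀ {Γ} → Γ ⊢ ~ NE → Γ ⊢ bot
  ¬NE₂ : ∀ {Γ} → Γ ⊢ bot → Γ ⊢ ~ NE
  ∨I   : ∀ {Γ φ ψ} → ML ψ → Γ ⊢ φ → Γ ⊢ φ ∨ ψ
  ∨dup : ∀ {Γ φ} → Γ ⊢ φ → Γ ⊢ φ ∨ φ
  ∨com : ∀ {Γ φ ψ} → Γ ⊢ φ ∨ ψ → Γ ⊢ ψ ∨ φ
  ∨E   : ∀ {Γ Δ φ ψ χ} → AllML Δ → Γ ⊢ φ ∨ ψ → (φ ∷ Δ) ⊢ χ → (ψ ∷ Δ) ⊢ χ →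
         (Γ ++ Δ) ⊢ χ
  ∨Mon : ∀ {Γ Δ φ ψ χ} → AllML Δ → Γ ⊢ φ ∨ ψ → (ψ ∷ Δ) ⊢ χ →
         (Γ ++ Δ) ⊢ φ ∨ χ
  ⊥∨E  : ∀ {Γ φ} → Γ ⊢ bot ∨ φ → Γ ⊢ φ
  ⊥⊥∨E : ∀ {Γ φ ψ} → Γ ⊢ botbot ∨ φ → Γ ⊢ ψ
  ◇Mon : ∀ {Γ φ ψ} → (φ ∷ []) ⊢ ψ → Γ ⊢ ◇ φ → Γ ⊢ ◇ ψ
  □Mon : ∀ {Γ φs ψ} → φs ⊢ ψ → All (λ φ → Γ ⊢ □ φ) φs → Γ ⊢ □ ψ
  ¬◇₁  : ∀ {Γ φ} → Γ ⊢ ~ ◇ φ → Γ ⊢ □ ~ φ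
  ¬◇₂  : ∀ {Γ φ} → Γ ⊢ □ ~ φ → Γ ⊢ ~ ◇ φ
  ◇NE  : ∀ {Γ φ ψ} → Γ ⊢ ◇ (φ ∨ (ψ ∧ NE)) → Γ ⊢ ◇ ψ
  ◇∨   : ∀ {Γ φ ψ} → Γ ⊢ ◇ φ → Γ ⊢ ◇ ψ → Γ ⊢ ◇ (φ ∨ ψ)
  □NE  : ∀ {Γ φ} → Γ ⊢ □ (φ ∧ NE) → Γ ⊢ ◇ φ
  □◇∨  : ∀ {Γ φ ψ} → Γ ⊢ □ φ → Γ ⊢ ◇ ψ → Γ ⊢ □ (φ ∨ ψ)
  ⊥NEtr : ∀ {Γ Δ} (C : DCtx) {ψ χ} → Γ ⊢ plug C ψ →
          (plug C (ψ ∧ NE) ∷ Δ) ⊢ χ → (plug C (ψ ∧ bot) ∷ Δ) ⊢ χ →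
          (Γ ++ Δ) ⊢ χ
  ◇⊥NE : ∀ {Γ} (C : DCtx) {ψ} → Γ ⊢ ◇ plug C ψ →
         Γ ⊢ (◇ plug C (ψ ∧ NE)) ∨ (◇ plug C (ψ ∧ bot))
  □⊥NE : ∀ {Γ} (C : DCtx) {ψ} → Γ ⊢ □ plug C ψ →
         Γ ⊢ (□ plug C (ψ ∧ NE)) ∨ (□ plug C (ψ ∧ bot))

_⊢ₛ_ : Pred Form 0ℓ → Form → Set
Φ ⊢ₛ ψ = Σ (List Form) λ Γ → All Φ Γ × (Γ ⊢ ψ)

{-# OPTIONS --safe #-}
-- The NE-sensitive side conditions of the rules are what is needed to use three
-- properties of NE-free formulas: they are downward closed, supported by the empty
-- state, and flat (support is decided pointwise on singletons); every formula is
-- closed under unions.  Classical logic enters twice: NE-free formulas are bivalent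
-- on singletons, which together with flatness validates ¬I, and a state can be split
-- by an arbitrary property of its worlds, which validates the ⊥NE rules.
module Submission where

open import Defs
open import Level using (0ℓ; Lift; lift; lower) renaming (suc to lsuc)
open import Axiom.ExcludedMiddle using (ExcludedMiddle)
open import Data.Empty using (⊥-elim)
open import Data.List using (_∷_)
open import Data.List.Relation.Unary.All as All using (All; []; _∷_)
open import Data.List.Relation.Unary.All.Properties using (++⁻)
open import Data.Product using (Σ; _×_; _,_; proj₁; proj₂)
open import Data.Sum as Sum using (_⊎_; inj₁; inj₂)
open import Function using (id; _∘_)
open import Relation.Nullary using (¬_; yes; no)
open import Relation.Nullary.Decidable using (True; False; toWitness; toWitnessFalse)
open import Relation.Unary using (Pred; _⊆_; _≐_; _∪_; _∩_; ∅; ｛_｝; ∁; Empty; Satisfiable)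
open import Relation.Unary.Properties using (≐-refl; ≐-sym; ≐-trans; ∅-Empty)
open import Relation.Unary.Algebra using (∪-comm; ∪-idem)
open import Relation.Binary.PropositionalEquality using (refl)

module Closure {M : Model} where

  private variable
    s t u t₁ t₂ u₁ u₂ : State M
    w : W M

  singleton⊆ : s w → ｛ w ｝ ⊆ s
  singleton⊆ sw refl = sw

  ≐∪⇒⊆ˡ : s ≐ (t ∪ u) → t ⊆ s
  ≐∪⇒⊆ˡ e tx = proj₂ e (inj₁ tx)

  ≐∪⇒⊆ʳ : s ≐ (t ∪ u) → u ⊆ s
  ≐∪⇒⊆ʳ e ux = proj₂ e (inj₂ ux)

  ≐-∪∅ : s ≐ (s ∪ ∅)
  ≐-∪∅ = inj₁ , Sum.[ id , (λ ()) ]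

  ≐-∅∪ : s ≐ (∅ ∪ s)
  ≐-∅∪ = inj₂ , Sum.[ (λ ()) , id ]

  ∪-interchange : t ≐ (t₁ ∪ t₂) → u ≐ (u₁ ∪ u₂) → (t ∪ u) ≐ ((t₁ ∪ u₁) ∪ (t₂ ∪ u₂))
  ∪-interchange et eu =
      Sum.[ Sum.map inj₁ inj₁ ∘ proj₁ et , Sum.map inj₂ inj₂ ∘ proj₁ eu ]
    , Sum.[ Sum.[ inj₁ ∘ ≐∪⇒⊆ˡ et , inj₂ ∘ ≐∪⇒⊆ˡ eu ]
          , Sum.[ inj₁ ∘ ≐∪⇒⊆ʳ et , inj₂ ∘ ≐∪⇒⊆ʳ eu ] ]

  restrict-≐∪ : t ⊆ s → s ≐ (u₁ ∪ u₂) → t ≐ ((t ∩ u₁) ∪ (t ∩ u₂))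
  restrict-≐∪ t⊆s e = (λ tx → Sum.map (tx ,_) (tx ,_) (proj₁ e (t⊆s tx))) , Sum.[ proj₁ , proj₁ ]

  mutual
    supp-resp-≐ : ∀ φ → s ≐ t → supp M s φ → supp M t φ
    supp-resp-≐ (var p) e (lift s⊆V) = lift (λ tx → s⊆V (proj₂ e tx))
    supp-resp-≐ (~ φ)   e h = anti-resp-≐ φ e h
    supp-resp-≐ (φ ∧ ψ) e (a , b) = supp-resp-≐ φ e a , supp-resp-≐ ψ e b
    supp-resp-≐ (φ ∨ ψ) e (t , u , lift e′ , a , b) = t , u , lift (≐-trans (≐-sym e) e′) , a , b
    supp-resp-≐ (◇ φ)   e h = λ w tw → h w (proj₂ e tw)
    supp-resp-≐ NE      e (lift (x , sx)) = lift (x , proj₁ e sx)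

    anti-resp-≐ : ∀ φ → s ≐ t → anti M s φ → anti M t φ
    anti-resp-≐ (var p) e (lift s∩V=∅) = lift (λ x (tx , v) → s∩V=∅ x (proj₂ e tx , v))
    anti-resp-≐ (~ φ)   e h = supp-resp-≐ φ e h
    anti-resp-≐ (φ ∧ ψ) e (t , u , lift e′ , a , b) = t , u , lift (≐-trans (≐-sym e) e′) , a , b
    anti-resp-≐ (φ ∨ ψ) e (a , b) = anti-resp-≐ φ e a , anti-resp-≐ ψ e b
    anti-resp-≐ (◇ φ)   e h = λ w tw → h w (proj₂ e tw)
    anti-resp-≐ NE      e (lift s=∅) = lift (λ x tx → s=∅ x (proj₂ e tx))

  mutual
    supp-∪ : ∀ φ → supp M t φ → supp M u φ → supp M (t ∪ u) φ
    supp-∪ (var p) (lift f) (lift g) = lift Sum.[ f , g ]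
    supp-∪ (~ φ)   a b = anti-∪ φ a b
    supp-∪ (φ ∧ ψ) (a , b) (c , d) = supp-∪ φ a c , supp-∪ ψ b d
    supp-∪ (φ ∨ ψ) (t₁ , t₂ , lift et , a , b) (u₁ , u₂ , lift eu , c , d) =
      (t₁ ∪ u₁) , (t₂ ∪ u₂) , lift (∪-interchange et eu) , supp-∪ φ a c , supp-∪ ψ b d
    supp-∪ (◇ φ)   f g = λ w → Sum.[ f w , g w ]
    supp-∪ NE      (lift (x , tx)) _ = lift (x , inj₁ tx)

    anti-∪ : ∀ φ → anti M t φ → anti M u φ → anti M (t ∪ u) φ
    anti-∪ (var p) (lift f) (lift g) =
      lift λ x → λ { (inj₁ tx , v) → f x (tx , v) ; (inj₂ ux , v) → g x (ux , v) }
    anti-∪ (~ φ)   a b = supp-∪ φ a b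
    anti-∪ (φ ∧ ψ) (t₁ , t₂ , lift et , a , b) (u₁ , u₂ , lift eu , c , d) =
      (t₁ ∪ u₁) , (t₂ ∪ u₂) , lift (∪-interchange et eu) , anti-∪ φ a c , anti-∪ ψ b d
    anti-∪ (φ ∨ ψ) (a , b) (c , d) = anti-∪ φ a c , anti-∪ ψ b d
    anti-∪ (◇ φ)   f g = λ w → Sum.[ f w , g w ]
    anti-∪ NE      (lift f) (lift g) = lift λ x → Sum.[ f x , g x ]

  mutual
    supp-⊆ : ∀ φ → ML φ → t ⊆ s → supp M s φ → supp M t φ
    supp-⊆ (var p) _ t⊆s (lift f) = lift (λ tx → f (t⊆s tx))
    supp-⊆ (~ φ)   m t⊆s h = anti-⊆ φ m t⊆s h
    supp-⊆ (φ ∧ ψ) (m₁ , m₂) t⊆s (a , b) = supp-⊆ φ m₁ t⊆s a , supp-⊆ ψ m₂ t⊆s b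
    supp-⊆ {t} (φ ∨ ψ) (m₁ , m₂) t⊆s (u₁ , u₂ , lift e , a , b) =
      (t ∩ u₁) , (t ∩ u₂) , lift (restrict-≐∪ t⊆s e) , supp-⊆ φ m₁ proj₂ a , supp-⊆ ψ m₂ proj₂ b
    supp-⊆ (◇ φ)   _ t⊆s f = λ w tw → f w (t⊆s tw)

    anti-⊆ : ∀ φ → ML φ → t ⊆ s → anti M s φ → anti M t φ
    anti-⊆ (var p) _ t⊆s (lift f) = lift (λ x (tx , v) → f x (t⊆s tx , v))
    anti-⊆ (~ φ)   m t⊆s h = supp-⊆ φ m t⊆s h
    anti-⊆ {t} (φ ∧ ψ) (m₁ , m₂) t⊆s (u₁ , u₂ , lift e , a , b) =
      (t ∩ u₁) , (t ∩ u₂) , lift (restrict-≐∪ t⊆s e) , anti-⊆ φ m₁ proj₂ a , anti-⊆ ψ m₂ proj₂ b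
    anti-⊆ (φ ∨ ψ) (m₁ , m₂) t⊆s (a , b) = anti-⊆ φ m₁ t⊆s a , anti-⊆ ψ m₂ t⊆s b
    anti-⊆ (◇ φ)   _ t⊆s f = λ w tw → f w (t⊆s tw)

  supp-⊆-All : ∀ {Γ} → AllML Γ → t ⊆ s → All (supp M s) Γ → All (supp M t) Γ
  supp-⊆-All []       t⊆s []       = []
  supp-⊆-All {Γ = φ ∷ Γ} (m ∷ ms) t⊆s (h ∷ hs) = supp-⊆ φ m t⊆s h ∷ supp-⊆-All ms t⊆s hs

  mutual
    supp-∅ : ∀ φ → ML φ → Empty s → supp M s φ
    supp-∅ (var p) _ s=∅ = lift (λ {x} sx → ⊥-elim (s=∅ x sx))
    supp-∅ (~ φ)   m s=∅ = anti-∅ φ m s=∅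
    supp-∅ (φ ∧ ψ) (m₁ , m₂) s=∅ = supp-∅ φ m₁ s=∅ , supp-∅ ψ m₂ s=∅
    supp-∅ {s} (φ ∨ ψ) (m₁ , m₂) s=∅ =
      s , s , lift (≐-sym (∪-idem s)) , supp-∅ φ m₁ s=∅ , supp-∅ ψ m₂ s=∅
    supp-∅ (◇ φ)   _ s=∅ = λ w sw → ⊥-elim (s=∅ w sw)

    anti-∅ : ∀ φ → ML φ → Empty s → anti M s φ
    anti-∅ (var p) _ s=∅ = lift (λ x (sx , _) → s=∅ x sx)
    anti-∅ (~ φ)   m s=∅ = supp-∅ φ m s=∅
    anti-∅ {s} (φ ∧ ψ) (m₁ , m₂) s=∅ =
      s , s , lift (≐-sym (∪-idem s)) , anti-∅ φ m₁ s=∅ , anti-∅ ψ m₂ s=∅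
    anti-∅ (φ ∨ ψ) (m₁ , m₂) s=∅ = anti-∅ φ m₁ s=∅ , anti-∅ ψ m₂ s=∅
    anti-∅ (◇ φ)   _ s=∅ = λ w sw → ⊥-elim (s=∅ w sw)

  supp∧anti⇒Empty : ∀ φ → ML φ → supp M s φ → anti M s φ → Empty s
  supp∧anti⇒Empty (var p) _ (lift s⊆V) (lift s∩V=∅) x sx = s∩V=∅ x (sx , s⊆V sx)
  supp∧anti⇒Empty (~ φ)   m a b = supp∧anti⇒Empty φ m b a
  supp∧anti⇒Empty (φ ∧ ψ) (m₁ , m₂) (a , b) (t , u , lift e , c , d) x sx with proj₁ e sx
  ... | inj₁ tx = supp∧anti⇒Empty φ m₁ (supp-⊆ φ m₁ (≐∪⇒⊆ˡ e) a) c x tx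
  ... | inj₂ ux = supp∧anti⇒Empty ψ m₂ (supp-⊆ ψ m₂ (≐∪⇒⊆ʳ e) b) d x ux
  supp∧anti⇒Empty (φ ∨ ψ) (m₁ , m₂) (t , u , lift e , a , b) (c , d) x sx with proj₁ e sx
  ... | inj₁ tx = supp∧anti⇒Empty φ m₁ a (anti-⊆ φ m₁ (≐∪⇒⊆ˡ e) c) x tx
  ... | inj₂ ux = supp∧anti⇒Empty ψ m₂ b (anti-⊆ ψ m₂ (≐∪⇒⊆ʳ e) d) x ux
  supp∧anti⇒Empty (◇ φ)   m f g w sw =
    let t , lift t⊆R , lift (v , tv) , a = f w sw
    in supp∧anti⇒Empty φ m a (anti-⊆ φ m t⊆R (g w sw)) v tv

  bot⇒Empty : supp M s bot → Empty s
  bot⇒Empty (a , b) = supp∧anti⇒Empty (var 0) _ a b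

  supp-bot-∨ : ∀ φ → supp M s (bot ∨ φ) → supp M s φ
  supp-bot-∨ {s} φ (t , u , lift e , t⊨bot , a) = supp-resp-≐ φ (≐∪⇒⊆ʳ e , s⊆u) a
    where
    s⊆u : s ⊆ u
    s⊆u sx = Sum.[ (λ tx → ⊥-elim (bot⇒Empty t⊨bot _ tx)) , id ] (proj₁ e sx)

  ¬supp-botbot-∨ : ∀ φ → ¬ supp M s (botbot ∨ φ)
  ¬supp-botbot-∨ φ (t , u , _ , (t⊨bot , lift (x , tx)) , _) = bot⇒Empty t⊨bot x tx

  singleton-supp-∨ : ∀ φ ψ → ML φ → ML ψ → supp M ｛ w ｝ (φ ∨ ψ) →
                     supp M ｛ w ｝ φ ⊎ supp M ｛ w ｝ ψ
  singleton-supp-∨ φ ψ m₁ m₂ (t , u , lift e , a , b) =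
    Sum.map (λ tw → supp-⊆ φ m₁ (singleton⊆ tw) a) (λ uw → supp-⊆ ψ m₂ (singleton⊆ uw) b)
            (proj₁ e refl)

  Flat : Form → Set₁
  Flat φ = ∀ {s} → (∀ w → s w → supp M ｛ w ｝ φ) → supp M s φ

  ◇-flat : ∀ φ → Flat (◇ φ)
  ◇-flat φ h w sw = h w sw w refl

  □-flat : ∀ φ → Flat (□ φ)
  □-flat φ h w sw = h w sw w refl

module Classical (lem : ∀ {ℓ} → ExcludedMiddle ℓ) {M : Model} where

  open Closure {M = M}

  private variable
    s : State M

  -- The two halves are stated with True/False of the decision so that they
  -- stay in Set although the property itself lives in Set₁.
  partition : (s : State M) (P : Pred (W M) (lsuc 0ℓ)) →
              Σ (State M) λ t → Σ (State M) λ u → s ≐ (t ∪ u) × t ⊆ P × u ⊆ ∁ P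
  partition s P = inside , outside , (cover , Sum.[ proj₁ , proj₁ ]) ,
                  (λ {w} (_ , p) → toWitness {a? = lem {P = P w}} p) ,
                  (λ {w} (_ , p) → toWitnessFalse {a? = lem {P = P w}} p)
    where
    inside outside : State M
    inside  w = s w × True  (lem {P = P w})
    outside w = s w × False (lem {P = P w})

    cover : s ⊆ (inside ∪ outside)
    cover {w} sw with lem {P = P w}
    ... | yes _ = inj₁ (sw , _)
    ... | no  _ = inj₂ (sw , _)

  ∨-flat-intro : ∀ φ ψ → Flat φ → Flat ψ →
                 (∀ w → s w → supp M ｛ w ｝ φ ⊎ supp M ｛ w ｝ ψ) → supp M s (φ ∨ ψ)
  ∨-flat-intro {s} φ ψ flatφ flatψ h =
    let t , u , e , t⊨φ , u⊭φ = partition s (λ w → supp M ｛ w ｝ φ)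
    in t , u , lift e , flatφ (λ w tw → t⊨φ tw) , flatψ λ w uw →
         Sum.[ (λ a → ⊥-elim (u⊭φ uw a)) , id ] (h w (≐∪⇒⊆ʳ e uw))

  -- anti-flatness of φ is flatness of ~ φ, and anti M s (φ ∧ ψ) is by
  -- definition supp M s (~ φ ∨ ~ ψ), so both ∧ and ∨ reduce to ∨-flat-intro.
  mutual
    supp-flat : ∀ φ → ML φ → Flat φ
    supp-flat (var p) _ h = lift (λ {x} sx → lower (h x sx) refl)
    supp-flat (~ φ)   m h = anti-flat φ m h
    supp-flat (φ ∧ ψ) (m₁ , m₂) h =
      supp-flat φ m₁ (λ w sw → proj₁ (h w sw)) , supp-flat ψ m₂ (λ w sw → proj₂ (h w sw))
    supp-flat (φ ∨ ψ) (m₁ , m₂) h =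
      ∨-flat-intro φ ψ (supp-flat φ m₁) (supp-flat ψ m₂)
        (λ w sw → singleton-supp-∨ φ ψ m₁ m₂ (h w sw))
    supp-flat (◇ φ)   _ h = ◇-flat φ h

    anti-flat : ∀ φ → ML φ → Flat (~ φ)
    anti-flat (var p) _ h = lift (λ x (sx , v) → lower (h x sx) x (refl , v))
    anti-flat (~ φ)   m h = supp-flat φ m h
    anti-flat (φ ∧ ψ) (m₁ , m₂) h =
      ∨-flat-intro (~ φ) (~ ψ) (anti-flat φ m₁) (anti-flat ψ m₂)
        (λ w sw → singleton-supp-∨ (~ φ) (~ ψ) m₁ m₂ (h w sw))
    anti-flat (φ ∨ ψ) (m₁ , m₂) h =
      anti-flat φ m₁ (λ w sw → proj₁ (h w sw)) , anti-flat ψ m₂ (λ w sw → proj₂ (h w sw))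
    anti-flat (◇ φ)   _ h = λ w sw → h w sw w refl

  singleton-bivalent : ∀ φ → ML φ → ∀ w → supp M ｛ w ｝ φ ⊎ anti M ｛ w ｝ φ
  singleton-bivalent (var p) _ w with lem {P = V M p w}
  ... | yes v = inj₁ (lift λ { refl → v })
  ... | no ¬v = inj₂ (lift λ { _ (refl , v) → ¬v v })
  singleton-bivalent (~ φ) m w = Sum.swap (singleton-bivalent φ m w)
  singleton-bivalent (φ ∧ ψ) (m₁ , m₂) w
    with singleton-bivalent φ m₁ w | singleton-bivalent ψ m₂ w
  ... | inj₁ a | inj₁ b = inj₁ (a , b)
  ... | inj₂ a | _      = inj₂ (｛ w ｝ , ∅ , lift ≐-∪∅ , a , anti-∅ ψ m₂ ∅-Empty)
  ... | inj₁ _ | inj₂ b = inj₂ (∅ , ｛ w ｝ , lift ≐-∅∪ , anti-∅ φ m₁ ∅-Empty , b)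
  singleton-bivalent (φ ∨ ψ) (m₁ , m₂) w
    with singleton-bivalent φ m₁ w | singleton-bivalent ψ m₂ w
  ... | inj₂ a | inj₂ b = inj₂ (a , b)
  ... | inj₁ a | _      = inj₁ (｛ w ｝ , ∅ , lift ≐-∪∅ , a , supp-∅ ψ m₂ ∅-Empty)
  ... | inj₂ _ | inj₁ b = inj₁ (∅ , ｛ w ｝ , lift ≐-∅∪ , supp-∅ φ m₁ ∅-Empty , b)
  singleton-bivalent (◇ φ) m w
    with lem {P = Σ (W M) λ v → R M w v × supp M ｛ v ｝ φ}
  ... | yes (v , r , a) = inj₁ λ { _ refl → ｛ v ｝ , lift (λ { refl → r }) , lift (v , refl) , a }
  ... | no ∄v = inj₂ λ { _ refl → anti-flat φ m λ v r →
                           Sum.[ (λ a → ⊥-elim (∄v (v , r , a))) , id ] (singleton-bivalent φ m v) }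

  anti-from-singletons : ∀ α → ML α → (∀ w → s w → ¬ supp M ｛ w ｝ α) → anti M s α
  anti-from-singletons α m h = anti-flat α m λ w sw →
    Sum.[ (λ a → ⊥-elim (h w sw a)) , id ] (singleton-bivalent α m w)

  plug-split : ∀ C ψ → supp M s (plug C ψ) →
               supp M s (plug C (ψ ∧ NE)) ⊎ supp M s (plug C (ψ ∧ bot))
  plug-split {s} hole _ a with lem {P = Satisfiable s}
  ... | yes s≠∅ = inj₁ (a , lift s≠∅)
  ... | no  s=∅ = inj₂ (a , supp-∅ bot _ λ x sx → s=∅ (x , sx))
  plug-split (C ∧ₗ φ) ψ (a , b) = Sum.map (_, b) (_, b) (plug-split C ψ a)
  plug-split (φ ∧ᵣ C) ψ (a , b) = Sum.map (a ,_) (a ,_) (plug-split C ψ b)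
  plug-split (C ∨ₗ φ) ψ (t , u , e , a , b) =
    Sum.map (λ a′ → t , u , e , a′ , b) (λ a′ → t , u , e , a′ , b) (plug-split C ψ a)
  plug-split (φ ∨ᵣ C) ψ (t , u , e , a , b) =
    Sum.map (λ b′ → t , u , e , a , b′) (λ b′ → t , u , e , a , b′) (plug-split C ψ b)

  ◇-plug-split : ∀ C ψ → supp M s (◇ plug C ψ) →
                 supp M s (◇ plug C (ψ ∧ NE) ∨ ◇ plug C (ψ ∧ bot))
  ◇-plug-split C ψ h =
    ∨-flat-intro (◇ plug C (ψ ∧ NE)) (◇ plug C (ψ ∧ bot))
                 (◇-flat (plug C (ψ ∧ NE))) (◇-flat (plug C (ψ ∧ bot))) λ w sw →
    let t , t⊆R , t≠∅ , a = h w sw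
    in Sum.map (λ a′ → λ { _ refl → t , t⊆R , t≠∅ , a′ })
               (λ a′ → λ { _ refl → t , t⊆R , t≠∅ , a′ }) (plug-split C ψ a)

  □-plug-split : ∀ C ψ → supp M s (□ plug C ψ) →
                 supp M s (□ plug C (ψ ∧ NE) ∨ □ plug C (ψ ∧ bot))
  □-plug-split C ψ h =
    ∨-flat-intro (□ plug C (ψ ∧ NE)) (□ plug C (ψ ∧ bot))
                 (□-flat (plug C (ψ ∧ NE))) (□-flat (plug C (ψ ∧ bot))) λ w sw →
    Sum.map (λ a → λ { _ refl → a }) (λ a → λ { _ refl → a }) (plug-split C ψ (h w sw))

  mutual
    sound : ∀ {Γ φ} → Γ ⊢ φ → (s : State M) → All (supp M s) Γ → supp M s φ
    sound (hyp φ∈Γ) s hs = All.lookup hs φ∈Γ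
    sound (weak Γ⊆Δ d) s hs = sound d s (All.tabulate λ φ∈Γ → All.lookup hs (Γ⊆Δ φ∈Γ))
    sound (∧I d e) s hs = sound d s hs , sound e s hs
    sound (∧E₁ d)  s hs = proj₁ (sound d s hs)
    sound (∧E₂ d)  s hs = proj₂ (sound d s hs)
    sound (¬I {α = α} mα mΓ d) s hs = anti-from-singletons α mα λ w sw a →
      bot⇒Empty (sound d ｛ w ｝ (a ∷ supp-⊆-All mΓ (singleton⊆ sw) hs)) w refl
    sound (¬E {α = α} {β} mα mβ d e) s hs =
      supp-∅ β mβ (supp∧anti⇒Empty α mα (sound d s hs) (sound e s hs))
    sound (¬¬E d) = sound d
    sound (¬¬I d) = sound d
    sound (dm∧₁ d) = sound d
    sound (dm∧₂ d) = sound d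
    sound (dm∨₁ d) = sound d
    sound (dm∨₂ d) = sound d
    sound (¬NE₁ d) s hs = supp-∅ bot _ (lower (sound d s hs))
    sound (¬NE₂ d) s hs = lift (bot⇒Empty (sound d s hs))
    sound (∨I {ψ = ψ} m d) s hs = s , ∅ , lift ≐-∪∅ , sound d s hs , supp-∅ ψ m ∅-Empty
    sound (∨dup d) s hs = s , s , lift (≐-sym (∪-idem s)) , sound d s hs , sound d s hs
    sound (∨com d) s hs =
      let t , u , lift e , a , b = sound d s hs
      in u , t , lift (≐-trans e (∪-comm t u)) , b , a
    sound (∨E {Γ} {χ = χ} mΔ d d₁ d₂) s hs =
      let hΓ , hΔ = ++⁻ Γ hs
          t , u , lift e , a , b = sound d s hΓ
      in supp-resp-≐ χ (≐-sym e)
           (supp-∪ χ (sound d₁ t (a ∷ supp-⊆-All mΔ (≐∪⇒⊆ˡ e) hΔ))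
                     (sound d₂ u (b ∷ supp-⊆-All mΔ (≐∪⇒⊆ʳ e) hΔ)))
    sound (∨Mon {Γ} mΔ d d₁) s hs =
      let hΓ , hΔ = ++⁻ Γ hs
          t , u , lift e , a , b = sound d s hΓ
      in t , u , lift e , a , sound d₁ u (b ∷ supp-⊆-All mΔ (≐∪⇒⊆ʳ e) hΔ)
    sound (⊥∨E {φ = φ} d) s hs = supp-bot-∨ φ (sound d s hs)
    sound (⊥⊥∨E {φ = φ} d) s hs = ⊥-elim (¬supp-botbot-∨ φ (sound d s hs))
    sound (◇Mon d₁ d) s hs w sw =
      let t , t⊆R , t≠∅ , a = sound d s hs w sw
      in t , t⊆R , t≠∅ , sound d₁ t (a ∷ [])
    sound (□Mon d ds) s hs w sw = sound d (succs M w) (sound-□s ds s hs w sw)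
    sound (¬◇₁ d) = sound d
    sound (¬◇₂ d) = sound d
    sound (◇NE d) s hs w sw =
      let t , lift t⊆R , _ , _ , t₂ , lift e , _ , a , lift t₂≠∅ = sound d s hs w sw
      in t₂ , lift (λ x → t⊆R (≐∪⇒⊆ʳ e x)) , lift t₂≠∅ , a
    sound (◇∨ d e) s hs w sw =
      let t₁ , lift t₁⊆R , lift (v , t₁v) , a = sound d s hs w sw
          t₂ , lift t₂⊆R , _ , b = sound e s hs w sw
      in (t₁ ∪ t₂) , lift Sum.[ t₁⊆R , t₂⊆R ] , lift (v , inj₁ t₁v) ,
         t₁ , t₂ , lift ≐-refl , a , b
    sound (□NE d) s hs w sw =
      let a , R≠∅ = sound d s hs w sw
      in succs M w , lift id , R≠∅ , a
    sound (□◇∨ d e) s hs w sw =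
      let t , lift t⊆R , _ , b = sound e s hs w sw
      in succs M w , t , lift (inj₁ , Sum.[ id , t⊆R ]) , sound d s hs w sw , b
    sound (⊥NEtr {Γ} C d d₁ d₂) s hs =
      let hΓ , hΔ = ++⁻ Γ hs
      in Sum.[ (λ a → sound d₁ s (a ∷ hΔ)) , (λ a → sound d₂ s (a ∷ hΔ)) ]
           (plug-split C _ (sound d s hΓ))
    sound (◇⊥NE C d) s hs = ◇-plug-split C _ (sound d s hs)
    sound (□⊥NE C d) s hs = □-plug-split C _ (sound d s hs)

    sound-□s : ∀ {Γ φs} → All (λ φ → Γ ⊢ □ φ) φs → (s : State M) →
               All (supp M s) Γ → ∀ w → s w → All (supp M (succs M w)) φs
    sound-□s []       s hs w sw = []
    sound-□s (d ∷ ds) s hs w sw = sound d s hs w sw ∷ sound-□s ds s hs w sw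

theorem4p34 : (lem : ∀ {ℓ} → ExcludedMiddle ℓ) (Φ : Pred Form 0ℓ) (ψ : Form) →
    Φ ⊢ₛ ψ → Φ ⊨ₛ ψ
theorem4p34 lem Φ ψ (Γ , Γ⊆Φ , d) M s s⊨Φ =
  Classical.sound lem {M} d s (All.map (λ {φ} → s⊨Φ φ) Γ⊆Φ)
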